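{- Let $Z$ be the $k\times k$ grid, for any integer $k\geq 2$, and let $\Gamma$ be the set of vertices in the first row of $Z$. Let $(A,B)$ be any partition of $V(Z)$, denote $\Gamma_A=\Gamma\cap A$ and $\Gamma_B=\Gamma\cap B$, and assume that $|\Gamma_B|\leq|\Gamma_A|$. Then $|B|\leq 4|E(A,B)|^2$.
   Context: $E(A,B)$ denotes the set of edges of $Z$ with one endpoint in $A$ and the other in $B$. -}

module Defs where

open import Data.Nat using (ℕ; zero; suc; _+_)
open import Data.Bool using (Bool; true; false; if_then_else_; _xor_)
open import Data.Fin using (Fin; zero; suc; inject₁)
open import Data.Product using (_×_; _,_)
open import Data.List using (List; map; allFin)
open import Data.Nat.ListAction using (sum)

Σ[_] : (n : ℕ) → (Fin n → ℕ) → ℕ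
Σ[ n ] f = sum (map f (allFin n))

[_] : Bool → ℕ
[ b ] = if b then 1 else 0

-- The k×k grid Z: vertices are pairs (row , column) in Fin k × Fin k;
-- (r , c) is adjacent to (r , c+1) and to (r+1 , c).
Vertex : ℕ → Set
Vertex k = Fin k × Fin k

-- A partition (A , B) of V(Z) is given by its characteristic function:
-- inA v = true iff v ∈ A (so v ∈ B iff inA v = false).
Partition : ℕ → Set
Partition k = Vertex k → Bool

sizeB : (k : ℕ) → Partition k → ℕ
sizeB k inA = Σ[ k ] λ r → Σ[ k ] λ c → if inA (r , c) then 0 else 1

-- |Γ_A| and |Γ_B|, Γ = first row (row index zero); only defined for k = suc m
ΓA : (m : ℕ) → Partition (suc m) → ℕ
ΓA m inA = Σ[ suc m ] λ c → [ inA (zero , c) ]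

ΓB : (m : ℕ) → Partition (suc m) → ℕ
ΓB m inA = Σ[ suc m ] λ c → if inA (zero , c) then 0 else 1

-- |E(A,B)|: number of grid edges with endpoints on different sides.
-- Horizontal edges {(r , c) , (r , c+1)} and vertical edges
-- {(r , c) , (r+1 , c)}, for r, c ranging appropriately (k = suc m).
crossing : (m : ℕ) → Partition (suc m) → ℕ
crossing m inA =
    (Σ[ suc m ] λ r → Σ[ m ] λ c → [ inA (r , inject₁ c) xor inA (r , suc c) ])
  + (Σ[ m ] λ r → Σ[ suc m ] λ c → [ inA (inject₁ r , c) xor inA (suc r , c) ])

-- Count E(A,B) row by row and column by column: a row (or column) meeting
-- both A and B contributes at least one crossing edge.  If some row lies in
-- B, every column whose top vertex is in A is mixed, so |Γ_A| ≤ |E(A,B)| and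
-- k = |Γ_A| + |Γ_B| ≤ 2|E(A,B)|.  Otherwise, if some column lies in B, every
-- row is mixed and k ≤ |E(A,B)|.  In both cases |B| ≤ k² ≤ 4|E(A,B)|².
-- Finally, if no row and no column lies in B, every vertex of B sits in a
-- mixed row and a mixed column, so |B| ≤ (#mixed rows)(#mixed columns)
-- ≤ |E(A,B)|².
module Submission where

open import Defs
open import Data.Nat using (ℕ; zero; suc; _≤_; _*_; _+_; z≤n)
open import Data.Nat.Properties
  using (+-*-semiring; +-mono-≤; *-mono-≤; ≤-refl; ≤-trans; m≤m+n; m≤n+m; m≤n*m;
         n≢0⇒n>0; m+n≡0⇒m≡0; m+n≡0⇒n≡0; *-identityʳ; module ≤-Reasoning)
open import Data.Nat.Solver using (module +-*-Solver)
import Data.Nat.ListAction as List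
open import Data.Bool using (Bool; true; false; _xor_; if_then_else_)
open import Data.Bool.Properties using (_≟_; ¬-not)
open import Data.Fin using (Fin; zero; suc; inject₁)
open import Data.Fin.Properties using (any?; all?; ¬∀⟶∃¬)
open import Data.List using (tabulate)
open import Data.List.Properties using (map-tabulate)
open import Data.Product using (_,_; curry)
open import Relation.Binary.PropositionalEquality hiding ([_])
open import Relation.Nullary using (¬_; Dec; yes; no)
open import Algebra.Properties.Semiring.Sum +-*-semiring
  using (sum; sum-syntax; ∑-distrib-+; ∑-comm; sum-cong-≗; *-distribˡ-sum; *-distribʳ-sum)

Σ≡∑ : ∀ n (f : Fin n → ℕ) → Σ[ n ] f ≡ ∑[ i < n ] f i
Σ≡∑ n f = trans (cong List.sum (map-tabulate (λ i → i) f)) (sum-tabulate n f)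
  where
  sum-tabulate : ∀ n (g : Fin n → ℕ) → List.sum (tabulate g) ≡ sum g
  sum-tabulate zero    g = refl
  sum-tabulate (suc n) g = cong (g zero +_) (sum-tabulate n (λ i → g (suc i)))

ΣΣ≡∑∑ : ∀ m n (f : Fin m → Fin n → ℕ) →
  (Σ[ m ] λ i → Σ[ n ] λ j → f i j) ≡ ∑[ i < m ] ∑[ j < n ] f i j
ΣΣ≡∑∑ m n f = trans (Σ≡∑ m _) (sum-cong-≗ (λ i → Σ≡∑ n (f i)))

∑-mono-≤ : ∀ n {f g : Fin n → ℕ} → (∀ i → f i ≤ g i) → sum f ≤ sum g
∑-mono-≤ zero    f≤g = z≤n
∑-mono-≤ (suc n) f≤g = +-mono-≤ (f≤g zero) (∑-mono-≤ n (λ i → f≤g (suc i)))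

∑-const : ∀ n x → ∑[ i < n ] x ≡ n * x
∑-const zero    x = refl
∑-const (suc n) x = cong (x +_) (∑-const n x)

∑∑-* : ∀ m n (f : Fin m → ℕ) (g : Fin n → ℕ) →
  ∑[ i < m ] ∑[ j < n ] (f i * g j) ≡ sum f * sum g
∑∑-* m n f g = begin
  ∑[ i < m ] ∑[ j < n ] (f i * g j) ≡⟨ sum-cong-≗ (λ i → sym (*-distribˡ-sum (f i) g)) ⟩
  ∑[ i < m ] (f i * sum g)          ≡⟨ sym (*-distribʳ-sum (sum g) f) ⟩
  sum f * sum g                     ∎
  where open ≡-Reasoning

[b]+[¬b]≡1 : ∀ b → [ b ] + (if b then 0 else 1) ≡ 1
[b]+[¬b]≡1 true  = refl
[b]+[¬b]≡1 false = refl

[b]≤ : ∀ b {x} → (b ≡ true → 1 ≤ x) → [ b ] ≤ x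
[b]≤ true  1≤x = 1≤x refl
[b]≤ false _   = z≤n

[¬b]≤ : ∀ b {x} → (b ≡ false → 1 ≤ x) → (if b then 0 else 1) ≤ x
[¬b]≤ true  _   = z≤n
[¬b]≤ false 1≤x = 1≤x refl

[xor]≡0⇒≡ : ∀ a b → [ a xor b ] ≡ 0 → a ≡ b
[xor]≡0⇒≡ true  true  _ = refl
[xor]≡0⇒≡ false false _ = refl
[xor]≡0⇒≡ true  false ()
[xor]≡0⇒≡ false true  ()

AllFalse : ∀ {n} → (Fin n → Bool) → Set
AllFalse g = ∀ i → g i ≡ false

AllFalse? : ∀ {n} (g : Fin n → Bool) → Dec (AllFalse g)
AllFalse? g = all? (λ i → g i ≟ false)

switches : ∀ {n} → (Fin (suc n) → Bool) → ℕ
switches {n} g = ∑[ i < n ] [ g (inject₁ i) xor g (suc i) ]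

switches≡0⇒constant : ∀ {n} (g : Fin (suc n) → Bool) → switches g ≡ 0 → ∀ i → g i ≡ g zero
switches≡0⇒constant         g _ zero    = refl
switches≡0⇒constant {suc n} g s≡0 (suc i) = begin
  g (suc i)    ≡⟨ switches≡0⇒constant (λ j → g (suc j)) (m+n≡0⇒n≡0 _ s≡0) i ⟩
  g (suc zero) ≡⟨ sym ([xor]≡0⇒≡ (g zero) (g (suc zero)) (m+n≡0⇒m≡0 _ s≡0)) ⟩
  g zero       ∎
  where open ≡-Reasoning

1≤switches : ∀ {n} (g : Fin (suc n) → Bool) {i j} → g i ≡ true → g j ≡ false → 1 ≤ switches g
1≤switches g {i} {j} gi≡true gj≡false = n≢0⇒n>0 λ s≡0 →
  let constant = switches≡0⇒constant g s≡0 in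
  true≢false (trans (sym gi≡true) (trans (constant i) (trans (sym (constant j)) gj≡false)))
  where
  true≢false : true ≢ false
  true≢false ()

1≤switches-of-partial : ∀ {n} (g : Fin (suc n) → Bool) {j} →
  ¬ AllFalse g → g j ≡ false → 1 ≤ switches g
1≤switches-of-partial {n} g not-all-false gj≡false
  with ¬∀⟶∃¬ (suc n) (λ i → g i ≡ false) (λ i → g i ≟ false) not-all-false
... | i , gi≢false = 1≤switches g (¬-not gi≢false) gj≡false

module Grid (m : ℕ) (inA : Partition (suc m)) where

  k : ℕ
  k = suc m

  row : Fin k → Fin k → Bool
  row r c = inA (r , c)

  column : Fin k → Fin k → Bool
  column c r = inA (r , c)

  inB : Fin k → Fin k → ℕ
  inB r c = if inA (r , c) then 0 else 1

  cut horizontal vertical : ℕ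
  cut        = crossing m inA
  horizontal = ∑[ r < k ] switches (row r)
  vertical   = ∑[ c < k ] switches (column c)

  cut-split : cut ≡ horizontal + vertical
  cut-split = cong₂ _+_ (ΣΣ≡∑∑ k m horizontal-edge)
                        (trans (ΣΣ≡∑∑ m k vertical-edge) (∑-comm vertical-edge))
    where
    horizontal-edge : Fin k → Fin m → ℕ
    horizontal-edge r c = [ inA (r , inject₁ c) xor inA (r , suc c) ]
    vertical-edge : Fin m → Fin k → ℕ
    vertical-edge r c = [ inA (inject₁ r , c) xor inA (suc r , c) ]

  horizontal≤cut : horizontal ≤ cut
  horizontal≤cut = subst (horizontal ≤_) (sym cut-split) (m≤m+n horizontal vertical)

  vertical≤cut : vertical ≤ cut
  vertical≤cut = subst (vertical ≤_) (sym cut-split) (m≤n+m vertical horizontal)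

  ∑1≡k : ∑[ i < k ] 1 ≡ k
  ∑1≡k = trans (∑-const k 1) (*-identityʳ k)

  sizeB≤k*k : sizeB k inA ≤ k * k
  sizeB≤k*k = begin
    sizeB k inA             ≡⟨ ΣΣ≡∑∑ k k inB ⟩
    ∑[ r < k ] ∑[ c < k ] inB r c
      ≤⟨ ∑-mono-≤ k (λ r → ∑-mono-≤ k (λ c → [¬b]≤ (inA (r , c)) (λ _ → ≤-refl))) ⟩
    ∑[ r < k ] ∑[ c < k ] 1 ≡⟨ ∑-const k (∑[ c < k ] 1) ⟩
    k * ∑[ c < k ] 1        ≡⟨ cong (k *_) ∑1≡k ⟩
    k * k                   ∎
    where open ≤-Reasoning

  k≤2cut⇒bound : k ≤ cut + cut → sizeB k inA ≤ 4 * (cut * cut)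
  k≤2cut⇒bound k≤2cut = ≤-trans sizeB≤k*k
    (subst (k * k ≤_) (square-double cut) (*-mono-≤ k≤2cut k≤2cut))
    where
    open +-*-Solver
    square-double : ∀ c → (c + c) * (c + c) ≡ 4 * (c * c)
    square-double = solve 1 (λ c → (c :+ c) :* (c :+ c) := con 4 :* (c :* c)) refl

  ΓA+ΓB≡k : ΓA m inA + ΓB m inA ≡ k
  ΓA+ΓB≡k = begin
    ΓA m inA + ΓB m inA                     ≡⟨ cong₂ _+_ (Σ≡∑ k inΓA) (Σ≡∑ k (inB zero)) ⟩
    sum inΓA + sum (inB zero)               ≡⟨ sym (∑-distrib-+ inΓA (inB zero)) ⟩
    ∑[ c < k ] (inΓA c + inB zero c)        ≡⟨ sum-cong-≗ (λ c → [b]+[¬b]≡1 (inA (zero , c))) ⟩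
    ∑[ c < k ] 1                            ≡⟨ ∑1≡k ⟩
    k                                       ∎
    where
    open ≡-Reasoning
    inΓA : Fin k → ℕ
    inΓA c = [ inA (zero , c) ]

  B-row⇒k≤2cut : ∀ r₀ → AllFalse (row r₀) → ΓB m inA ≤ ΓA m inA → k ≤ cut + cut
  B-row⇒k≤2cut r₀ r₀-in-B ΓB≤ΓA = begin
    k                   ≡⟨ sym ΓA+ΓB≡k ⟩
    ΓA m inA + ΓB m inA ≤⟨ +-mono-≤ ΓA≤cut (≤-trans ΓB≤ΓA ΓA≤cut) ⟩
    cut + cut           ∎
    where
    open ≤-Reasoning
    ΓA≤cut : ΓA m inA ≤ cut
    ΓA≤cut = begin
      ΓA m inA                      ≡⟨ Σ≡∑ k _ ⟩
      ∑[ c < k ] [ inA (zero , c) ] ≤⟨ ∑-mono-≤ k (λ c → [b]≤ (inA (zero , c))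
                                         (λ top-in-A → 1≤switches (column c) top-in-A (r₀-in-B c))) ⟩
      vertical                      ≤⟨ vertical≤cut ⟩
      cut                           ∎

  B-column⇒k≤horizontal : (∀ r → ¬ AllFalse (row r)) → ∀ c₀ → AllFalse (column c₀) → k ≤ horizontal
  B-column⇒k≤horizontal rows-meet-A c₀ c₀-in-B = begin
    k            ≡⟨ sym ∑1≡k ⟩
    ∑[ r < k ] 1 ≤⟨ ∑-mono-≤ k (λ r → 1≤switches-of-partial (row r) (rows-meet-A r) (c₀-in-B r)) ⟩
    horizontal   ∎
    where open ≤-Reasoning

  sizeB≤horizontal*vertical : (∀ r → ¬ AllFalse (row r)) → (∀ c → ¬ AllFalse (column c)) →
    sizeB k inA ≤ horizontal * vertical
  sizeB≤horizontal*vertical rows-meet-A columns-meet-A = begin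
    sizeB k inA                                ≡⟨ ΣΣ≡∑∑ k k inB ⟩
    ∑[ r < k ] ∑[ c < k ] inB r c              ≤⟨ ∑-mono-≤ k (λ r → ∑-mono-≤ k (inB≤ r)) ⟩
    ∑[ r < k ] ∑[ c < k ] (rowSwitches r * columnSwitches c)
                                               ≡⟨ ∑∑-* k k rowSwitches columnSwitches ⟩
    horizontal * vertical                      ∎
    where
    open ≤-Reasoning
    rowSwitches columnSwitches : Fin k → ℕ
    rowSwitches    r = switches (row r)
    columnSwitches c = switches (column c)
    inB≤ : ∀ r c → inB r c ≤ rowSwitches r * columnSwitches c
    inB≤ r c = [¬b]≤ (inA (r , c)) λ rc-in-B →
      *-mono-≤ (1≤switches-of-partial (row r) (rows-meet-A r) rc-in-B)
               (1≤switches-of-partial (column c) (columns-meet-A c) rc-in-B)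

claim2p18 : (m : ℕ) → 1 ≤ m → (inA : Partition (suc m)) →
    ΓB m inA ≤ ΓA m inA →
    sizeB (suc m) inA ≤ 4 * (crossing m inA * crossing m inA)
claim2p18 m _ inA ΓB≤ΓA = bound
  where
  open Grid m inA
  bound : sizeB k inA ≤ 4 * (cut * cut)
  bound with any? (λ r → AllFalse? (row r)) | any? (λ c → AllFalse? (column c))
  ... | yes (r₀ , r₀-in-B) | _                  =
    k≤2cut⇒bound (B-row⇒k≤2cut r₀ r₀-in-B ΓB≤ΓA)
  ... | no no-B-row        | yes (c₀ , c₀-in-B) =
    k≤2cut⇒bound (≤-trans (B-column⇒k≤horizontal (curry no-B-row) c₀ c₀-in-B)
                          (≤-trans horizontal≤cut (m≤m+n cut cut)))
  ... | no no-B-row        | no no-B-column     = begin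
    sizeB k inA           ≤⟨ sizeB≤horizontal*vertical (curry no-B-row) (curry no-B-column) ⟩
    horizontal * vertical ≤⟨ *-mono-≤ horizontal≤cut vertical≤cut ⟩
    cut * cut             ≤⟨ m≤n*m (cut * cut) 4 ⟩
    4 * (cut * cut)       ∎
    where open ≤-Reasoning
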